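{- Let $p$ be a prime number and $k$ an integer with $2\leq k\leq v-2$. Let $G$ and $G'$ be two graphs on the same vertex set $V$ of $v$ vertices (possibly infinite). Assume that for all $k$-element subsets $K$ of $V$, $e(G_{\restriction K}) \equiv e(G'_{\restriction K}) \pmod p$. 1) If $p\geq 3$ and $k\not\equiv 0,1 \pmod p$, then $G'=G$. 2) If $p\geq 3$ and $k\equiv 0 \pmod p$, then $G'=G$, or one of the graphs $G,G'$ is the complete graph and the other is the empty graph. 3) If $p=2$ and $k\equiv 2 \pmod 4$, then $G'=G$.
   Context: Graphs are simple undirected graphs (edges are 2-element subsets of $V$). For $K\subseteq V$, $G_{\restriction K}$ is the subgraph of $G$ induced on $K$, and $e(H)$ denotes the number of edges of a graph $H$. -}

module Defs where

open import Data.Bool using (Bool; true; false)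
open import Data.Nat using (ℕ; zero; suc; _+_)
open import Data.List using (List; []; _∷_; length)
open import Data.List.Relation.Unary.Unique.Propositional using (Unique)
open import Data.Integer using (ℤ; +_; _-_)
open import Data.Integer.Divisibility using (_∣_)
open import Data.Product using (_×_)
open import Relation.Binary.PropositionalEquality using (_≡_; _≢_)

-- A simple undirected graph on a (possibly infinite) vertex type V:
-- a symmetric, irreflexive adjacency relation (Bool-valued, so that
-- edge counts of finite induced subgraphs are defined).
record Graph (V : Set) : Set where
  field
    adj   : V → V → Bool
    sym   : ∀ x y → adj x y ≡ adj y x
    irrefl : ∀ x → adj x x ≡ false
open Graph public

degIn : {V : Set} → Graph V → V → List V → ℕ
degIn G x [] = 0
degIn G x (y ∷ ys) with adj G x y
... | true  = suc (degIn G x ys)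
... | false = degIn G x ys

-- e(G restricted to K), where K is given as a duplicate-free list of
-- vertices: number of unordered pairs {x,y} ⊆ K that are edges of G.
edgesIn : {V : Set} → Graph V → List V → ℕ
edgesIn G [] = 0
edgesIn G (x ∷ xs) = degIn G x xs + edgesIn G xs

IsKSubset : {V : Set} → ℕ → List V → Set
IsKSubset k K = Unique K × length K ≡ k

_≡_[mod_] : ℕ → ℕ → ℕ → Set
a ≡ b [mod p ] = (+ p) ∣ ((+ a) - (+ b))

SameGraph : {V : Set} → Graph V → Graph V → Set
SameGraph G G' = ∀ x y → adj G x y ≡ adj G' x y

Complete : {V : Set} → Graph V → Set
Complete G = ∀ x y → x ≢ y → adj G x y ≡ true

Empty : {V : Set} → Graph V → Set
Empty G = ∀ x y → adj G x y ≡ false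

module Submission where

-- Put d(x,y) = [xy ∈ G] − [xy ∈ G'] ∈ {−1,0,1} and, for a
-- duplicate-free list K of vertices, F(K) = Σ_{pairs {x,y} ⊆ K} d(x,y), so that
-- F(K) = e(G|K) − e(G'|K).  Call a size n "null" if F ≡ 0 (mod p) on all
-- n-sets; the hypothesis says that k is null.
--  * Double counting, Σ_{x ∈ U} F(U∖x) = (|U|−2)·F(U): if n+1 is null and
--    p ∤ n, then n+2 is null.  So k+1 is null when p ∤ k−1, and k+2 too when
--    moreover p ∤ k.
--  * Inclusion–exclusion, F(Z) − d(u,v) = F(Z∖u) + F(Z∖v) − F(Z∖{u,v}): if k
--    and k+1 are null, then d(u,v) ≡ F(Z) for every pair u,v of a (k+2)-set Z.
--  * As |d| ≤ 1, a congruence modulo p ≥ 2 between d and 0, or modulo p ≥ 3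
--    between two values of d, is an equality.  Part 1 follows from the nullity
--    of k+2, part 2 by comparing two pairs inside one (k+2)-set, and part 3
--    from F(K) ≡ C(k,2)·F(Z) for a k-set K ⊆ Z, where C(k,2) is odd.
-- The vertex type has no decidable equality, so the (k+2)-sets around given
-- vertices are only built under double negation; this suffices because every
-- conclusion is an equation between booleans or integers.

module SignedEdgeCounts where

  open import Defs hiding (sym)
  open import Level using (0ℓ)
  open import Function using (_∘_; _$_; case_of_)
  open import Data.Bool using (Bool; true; false) renaming (_≟_ to _≟ᵇ_)
  open import Data.Empty using (⊥-elim)
  open import Data.Nat as ℕ using (ℕ; zero; suc; z≤n; s≤s)
  import Data.Nat.Properties as ℕₚ
  import Data.Nat.Divisibility as ℕᵈ
  open import Data.Nat.Primality using (Prime; euclidsLemma; prime⇒nonTrivial)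
  open import Data.Nat.Base using (nonTrivial⇒n>1)
  open import Data.Nat.Tactic.RingSolver as ℕSolver using ()
  open import Data.Integer as ℤ using (ℤ; +_; 0ℤ; 1ℤ; -1ℤ; _+_; _-_; _*_; -_; ∣_∣)
  import Data.Integer.Properties as ℤₚ
  open import Data.Integer.Divisibility.Signed as ℤᵈ
    using (_∣_; ∣m∣n⇒∣m+n; ∣m∣n⇒∣m-n; ∣m⇒∣-m; ∣n⇒∣m*n; ∣ᵤ⇒∣; ∣⇒∣ᵤ)
  open import Data.Integer.Tactic.RingSolver using (solve-∀)
  open import Data.List using (List; []; _∷_; length; map; take; _++_)
  open import Data.List.Properties using (length-map; length-++; length-take)
  open import Data.List.Relation.Unary.All as All using (All; []; _∷_)
  open import Data.List.Relation.Unary.All.Properties using (¬Any⇒All¬; All¬⇒¬Any)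
    renaming (take⁺ to All-take⁺)
  open import Data.List.Relation.Unary.Any using (here; there)
  open import Data.List.Relation.Unary.AllPairs using ([]; _∷_)
  open import Data.List.Relation.Unary.Unique.Propositional using (Unique)
  open import Data.List.Relation.Unary.Unique.Propositional.Properties using (++⁺; take⁺)
  open import Data.List.Membership.Propositional using (_∈_; _∉_)
  open import Data.List.Membership.Propositional.Properties using (∈-∃++; ∈-map⁻; ∈-++⁺ˡ)
  open import Data.List.Relation.Binary.Subset.Propositional using (_⊆_)
  open import Data.List.Relation.Binary.Sublist.Propositional as Sublist
    using ([]; _∷_; _∷ʳ_) renaming (_⊆_ to _⊑_)
  open import Data.List.Relation.Binary.Sublist.Propositional.Properties using (All-resp-⊆)
  open import Data.List.Relation.Binary.Permutation.Propositional as Perm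
    using (_↭_; ↭-refl; ↭-prep; ↭-swap; ↭-trans; ↭-sym; ↭⇒↭ₛ)
  open import Data.List.Relation.Binary.Permutation.Propositional.Properties
    using (↭-length; ∈-resp-↭; shift)
  open import Data.Product using (Σ; _×_; _,_; proj₁; proj₂)
  open import Data.Sum using (_⊎_; inj₁; inj₂)
  open import Effect.Monad using (RawMonad)
  open import Relation.Nullary using (¬_; Dec; yes; no)
  open import Relation.Nullary.Decidable using (decidable-stable; ¬¬-excluded-middle)
  open import Relation.Nullary.Negation using (¬¬-Monad)
  open import Relation.Binary using (Setoid)
  import Relation.Binary.Reasoning.Setoid
  open import Relation.Binary.PropositionalEquality
    using (_≡_; _≢_; refl; sym; trans; cong; cong₂; subst; subst₂; setoid; module ≡-Reasoning)

  -- Constructions that need a case split on equality of vertices are carried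
  -- out in the double-negation monad.
  open RawMonad (¬¬-Monad {a = 0ℓ})

  sumOver : {A : Set} → (A → ℤ) → List A → ℤ
  sumOver f []       = 0ℤ
  sumOver f (a ∷ as) = f a + sumOver f as

  sumOver-map : {A B : Set} (f : B → ℤ) (g : A → B) (as : List A) →
                sumOver f (map g as) ≡ sumOver (f ∘ g) as
  sumOver-map f g []       = refl
  sumOver-map f g (a ∷ as) = cong (_+_ (f (g a))) (sumOver-map f g as)

  sumOver-shift : {A : Set} (c : ℤ) (f : A → ℤ) (as : List A) →
                  sumOver (λ a → c + f a) as ≡ + length as * c + sumOver f as
  sumOver-shift c f []       = refl
  sumOver-shift c f (a ∷ as) = begin
    c + f a + sumOver (λ a → c + f a) as
      ≡⟨ cong (_+_ (c + f a)) (sumOver-shift c f as) ⟩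
    c + f a + (+ length as * c + sumOver f as)
      ≡⟨ regroup c (f a) (+ length as) (sumOver f as) ⟩
    (1ℤ + + length as) * c + (f a + sumOver f as) ∎
    where
    open ≡-Reasoning
    regroup : ∀ c x n s → c + x + (n * c + s) ≡ (1ℤ + n) * c + (x + s)
    regroup = solve-∀

  minus-interchange : ∀ x y s t → x - y + (s - t) ≡ x + s - (y + t)
  minus-interchange = solve-∀

  sumOver-+ : {A : Set} (f g : A → ℤ) (as : List A) →
              sumOver (λ a → f a + g a) as ≡ sumOver f as + sumOver g as
  sumOver-+ f g []       = refl
  sumOver-+ f g (a ∷ as) rewrite sumOver-+ f g as =
    interchange (f a) (g a) (sumOver f as) (sumOver g as)
    where
    interchange : ∀ x y s t → x + y + (s + t) ≡ x + s + (y + t)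
    interchange = solve-∀

  sumOver-sub : {A : Set} (f g : A → ℤ) (as : List A) →
                sumOver (λ a → f a - g a) as ≡ sumOver f as - sumOver g as
  sumOver-sub f g []       = refl
  sumOver-sub f g (a ∷ as) rewrite sumOver-sub f g as =
    minus-interchange (f a) (g a) (sumOver f as) (sumOver g as)

  choose2 : ℕ → ℕ
  choose2 zero    = 0
  choose2 (suc n) = n ℕ.+ choose2 n

  -- C(4q+2, 2) = (2q+1)(4q+1) is odd; by induction, since C(n+4,2) − C(n,2)
  -- = 2(2n+3) is even.
  choose2-odd : (q : ℕ) → Σ ℕ λ t → choose2 (2 ℕ.+ q ℕ.* 4) ≡ 1 ℕ.+ t ℕ.* 2
  choose2-odd zero    = 0 , refl
  choose2-odd (suc q) with t , odd ← choose2-odd q =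
    t ℕ.+ (3 ℕ.+ 2 ℕ.* n) , trans (cong (four-more n) odd) (four-more-odd n t)
    where
    n = 2 ℕ.+ q ℕ.* 4
    -- choose2 (4 + j) unfolds to four-more j (choose2 j)
    four-more : ℕ → ℕ → ℕ
    four-more j c = 3 ℕ.+ j ℕ.+ (2 ℕ.+ j ℕ.+ (1 ℕ.+ j ℕ.+ (j ℕ.+ c)))
    four-more-odd : ∀ j t → 3 ℕ.+ j ℕ.+ (2 ℕ.+ j ℕ.+ (1 ℕ.+ j ℕ.+ (j ℕ.+ (1 ℕ.+ t ℕ.* 2))))
                            ≡ 1 ℕ.+ (t ℕ.+ (3 ℕ.+ 2 ℕ.* j)) ℕ.* 2
    four-more-odd = ℕSolver.solve-∀

  2∤1+4q : ∀ q → ¬ (2 ℕᵈ.∣ 1 ℕ.+ q ℕ.* 4)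
  2∤1+4q q 2∣1+4q = 2≢1 (ℕᵈ.∣1⇒≡1 (ℕᵈ.∣m+n∣m⇒∣n 2∣4q+1 2∣4q))
    where
    2∣4q+1 : 2 ℕᵈ.∣ q ℕ.* 4 ℕ.+ 1
    2∣4q+1 = subst (2 ℕᵈ.∣_) (ℕₚ.+-comm 1 (q ℕ.* 4)) 2∣1+4q
    2∣4q : 2 ℕᵈ.∣ q ℕ.* 4
    2∣4q = ℕᵈ.∣-trans (ℕᵈ.divides 2 refl) (ℕᵈ.n∣m*n q)
    2≢1 : 2 ≢ 1
    2≢1 ()

  module Modulo (p : ℕ) where

    -- x ≈ y when p divides x − y (a record, so that x and y can be inferred).
    infix 4 _≈_
    record _≈_ (x y : ℤ) : Set where
      constructor by-divisibility
      field p∣x-y : + p ∣ x - y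
    open _≈_

    ≈-by : ∀ {x y z} → x - y ≡ z → + p ∣ z → x ≈ y
    ≈-by eq p∣z = by-divisibility (subst (+ p ∣_) (sym eq) p∣z)

    ≈-refl : ∀ {x} → x ≈ x
    ≈-refl {x} = ≈-by (ℤₚ.+-inverseʳ x) (ℤᵈ.divides 0ℤ refl)

    ≈-sym : ∀ {x y} → x ≈ y → y ≈ x
    ≈-sym {x} {y} x≈y = ≈-by (negate x y) (∣m⇒∣-m (p∣x-y x≈y))
      where
      negate : ∀ x y → y - x ≡ - (x - y)
      negate = solve-∀

    ≈-trans : ∀ {x y z} → x ≈ y → y ≈ z → x ≈ z
    ≈-trans {x} {y} {z} x≈y y≈z =
      ≈-by (telescope x y z) (∣m∣n⇒∣m+n (p∣x-y x≈y) (p∣x-y y≈z))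
      where
      telescope : ∀ x y z → x - z ≡ x - y + (y - z)
      telescope = solve-∀

    +-cong : ∀ {x x′ y y′} → x ≈ x′ → y ≈ y′ → x + y ≈ x′ + y′
    +-cong {x} {x′} {y} {y′} x≈x′ y≈y′ =
      ≈-by (interchange x x′ y y′) (∣m∣n⇒∣m+n (p∣x-y x≈x′) (p∣x-y y≈y′))
      where
      interchange : ∀ x x′ y y′ → x + y - (x′ + y′) ≡ x - x′ + (y - y′)
      interchange = solve-∀

    *-congˡ : ∀ c {x y} → x ≈ y → c * x ≈ c * y
    *-congˡ c {x} {y} x≈y = ≈-by (distrib c x y) (∣n⇒∣m*n c (p∣x-y x≈y))
      where
      distrib : ∀ c x y → c * x - c * y ≡ c * (x - y)
      distrib = solve-∀

    ≈-setoid : Setoid 0ℓ 0ℓ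
    ≈-setoid = record
      { Carrier       = ℤ
      ; _≈_           = _≈_
      ; isEquivalence = record { refl = ≈-refl ; sym = ≈-sym ; trans = ≈-trans } }

    module ≈-Reasoning = Relation.Binary.Reasoning.Setoid ≈-setoid

    ∣⇒≈0 : ∀ {x} → + p ∣ x → x ≈ 0ℤ
    ∣⇒≈0 {x} = ≈-by (ℤₚ.+-identityʳ x)

    ≈0⇒∣ : ∀ {x} → x ≈ 0ℤ → + p ∣ x
    ≈0⇒∣ {x} x≈0 = subst (+ p ∣_) (ℤₚ.+-identityʳ x) (p∣x-y x≈0)

    multiple≈0 : ∀ x → + p * x ≈ 0ℤ
    multiple≈0 x = ∣⇒≈0 (ℤᵈ.∣m⇒∣m*n x ℤᵈ.∣-refl)

    ≈-small : ∀ {x y} → x ≈ y → ∣ x - y ∣ ℕ.< p → x ≡ y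
    ≈-small {x} {y} x≈y small with ∣ x - y ∣ in dist
    ... | zero  = ℤₚ.i-j≡0⇒i≡j x y (ℤₚ.∣i∣≡0⇒i≡0 dist)
    ... | suc _ = ⊥-elim (ℕᵈ.>⇒∤ small (subst (p ℕᵈ.∣_) dist (∣⇒∣ᵤ (p∣x-y x≈y))))

    cancel : Prime p → ∀ c {x} → ¬ (p ℕᵈ.∣ c) → + c * x ≈ 0ℤ → x ≈ 0ℤ
    cancel p-prime c {x} p∤c cx≈0 with euclidsLemma c ∣ x ∣ p-prime p∣c∣x∣
      where
      p∣c∣x∣ : p ℕᵈ.∣ c ℕ.* ∣ x ∣
      p∣c∣x∣ = subst (p ℕᵈ.∣_) (ℤₚ.abs-* (+ c) x) (∣⇒∣ᵤ (≈0⇒∣ cx≈0))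
    ... | inj₁ p∣c = ⊥-elim (p∤c p∣c)
    ... | inj₂ p∣x = ∣⇒≈0 (∣ᵤ⇒∣ p∣x)

    odd-cancel : p ≡ 2 → ∀ t {x} → + (1 ℕ.+ t ℕ.* 2) * x ≈ 0ℤ → x ≈ 0ℤ
    odd-cancel p≡2 t {x} odd≈0 = begin
      x                                            ≡⟨ split (+ t) x ⟩
      (1ℤ + + t * + 2) * x + (- + t) * (+ 2 * x)
        ≡⟨ cong (λ n → (1ℤ + n) * x + (- + t) * (+ 2 * x)) (ℤₚ.pos-* t 2) ⟨
      + (1 ℕ.+ t ℕ.* 2) * x + (- + t) * (+ 2 * x)  ≈⟨ +-cong odd≈0 (*-congˡ (- + t) even≈0) ⟩
      0ℤ + (- + t) * 0ℤ                            ≡⟨ cong (_+_ 0ℤ) (ℤₚ.*-zeroʳ (- + t)) ⟩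
      0ℤ                                           ∎
      where
      open ≈-Reasoning
      even≈0 : + 2 * x ≈ 0ℤ
      even≈0 = subst (λ q → + q * x ≈ 0ℤ) p≡2 (multiple≈0 x)
      split : ∀ t x → x ≡ (1ℤ + t * + 2) * x + (- t) * (+ 2 * x)
      split = solve-∀

    sumOver-≈ : {A : Set} (f : A → ℤ) (c : ℤ) (as : List A) →
                (∀ {a} → a ∈ as → f a ≈ c) → sumOver f as ≈ + length as * c
    sumOver-≈ f c []       _  = ≈-refl
    sumOver-≈ f c (a ∷ as) fc = begin
      f a + sumOver f as       ≈⟨ +-cong (fc (here refl)) (sumOver-≈ f c as (fc ∘ there)) ⟩
      c + + length as * c      ≡⟨ ℤₚ.suc-* (+ length as) c ⟨
      ℤ.suc (+ length as) * c  ∎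
      where open ≈-Reasoning

  module _ {V : Set} where

    unique-⊑ : {xs ys : List V} → xs ⊑ ys → Unique ys → Unique xs
    unique-⊑ []         []      = []
    unique-⊑ (y ∷ʳ σ)   (_ ∷ u) = unique-⊑ σ u
    unique-⊑ (refl ∷ σ) (a ∷ u) = All-resp-⊆ σ a ∷ unique-⊑ σ u

    unique-↭ : {xs ys : List V} → xs ↭ ys → Unique xs → Unique ys
    unique-↭ σ = Unique-resp-↭ (↭⇒↭ₛ σ)
      where
      open import Data.List.Relation.Binary.Permutation.Setoid.Properties (setoid V)
        using (Unique-resp-↭)

    everywhere : {P : V → V → Set} → (∀ x y → Dec (P x y)) → (∀ x → P x x) →
                 (∀ x y → x ≢ y → ¬ ¬ P x y) → ∀ x y → P x y
    everywhere P? diagonal off-diagonal x y = decidable-stable (P? x y) do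
      x≟y ← ¬¬-excluded-middle {A = x ≡ y}
      case x≟y of λ where
        (yes refl) → pure (diagonal x)
        (no x≢y)   → off-diagonal x y x≢y

    two-distinct : (W : List V) → Unique W → 2 ℕ.≤ length W →
                   Σ V λ w₁ → Σ V λ w₂ → w₁ ≢ w₂
    two-distinct (w₁ ∷ w₂ ∷ _) ((w₁≢w₂ ∷ _) ∷ _) _ = w₁ , w₂ , w₁≢w₂
    two-distinct (_ ∷ [])      _ (s≤s ())

    extract : {u : V} {Z : List V} → u ∈ Z → Σ (List V) λ R → Z ↭ u ∷ R
    extract u∈Z with ys , zs , refl ← ∈-∃++ u∈Z = ys ++ zs , shift _ ys zs

    extractPair : {u v : V} {Z : List V} → u ∈ Z → v ∈ Z → u ≢ v →
                  Σ (List V) λ K → Z ↭ u ∷ v ∷ K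
    extractPair u∈Z v∈Z u≢v with R , σ ← extract u∈Z with ∈-resp-↭ σ v∈Z
    ... | here v≡u  = ⊥-elim (u≢v (sym v≡u))
    ... | there v∈R with K , τ ← extract v∈R = K , ↭-trans σ (↭-prep _ τ)

    dropOne : List V → List (List V)
    dropOne []      = []
    dropOne (x ∷ L) = L ∷ map (x ∷_) (dropOne L)

    length-dropOne : (L : List V) → length (dropOne L) ≡ length L
    length-dropOne []      = refl
    length-dropOne (x ∷ L) =
      cong suc (trans (length-map (x ∷_) (dropOne L)) (length-dropOne L))

    dropOne-↭ : {R U : List V} → R ∈ dropOne U → Σ V λ x → U ↭ x ∷ R
    dropOne-↭ {U = x ∷ L} (here refl) = x , ↭-refl
    dropOne-↭ {U = x ∷ L} (there R∈)
      with R′ , R′∈ , refl ← ∈-map⁻ (x ∷_) R∈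
      with y , σ ← dropOne-↭ R′∈ = y , ↭-trans (↭-prep x σ) (↭-swap x y ↭-refl)

    dedup : (S : List V) →
            ¬ ¬ (Σ (List V) λ S′ → Unique S′ × length S′ ℕ.≤ length S × S ⊆ S′)
    dedup []      = pure ([] , [] , z≤n , λ ())
    dedup (s ∷ S) = do
      (S′ , uS′ , S′≤S , S⊆S′) ← dedup S
      s∈S′? ← ¬¬-excluded-middle {A = s ∈ S′}
      pure $ case s∈S′? of λ where
        (yes s∈S′) → S′ , uS′ , ℕₚ.m≤n⇒m≤1+n S′≤S ,
                     λ { (here refl) → s∈S′ ; (there t∈S) → S⊆S′ t∈S }
        (no s∉S′)  → s ∷ S′ , ¬Any⇒All¬ S′ s∉S′ ∷ uS′ , s≤s S′≤S ,
                     λ { (here refl) → here refl ; (there t∈S) → there (S⊆S′ t∈S) }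

    -- Under double negation x can be deleted from a duplicate-free list W;
    -- as x occurs at most once, the length drops by at most one.
    removeOne : (x : V) (W : List V) → Unique W →
                ¬ ¬ (Σ (List V) λ W′ → W′ ⊑ W × x ∉ W′ × length W ℕ.≤ suc (length W′))
    removeOne x []      _          = pure ([] , [] , (λ ()) , z≤n)
    removeOne x (w ∷ W) (w∉W ∷ uW) = do
      x≟w ← ¬¬-excluded-middle {A = x ≡ w}
      case x≟w of λ where
        (yes refl) → pure (W , w ∷ʳ Sublist.⊆-refl , All¬⇒¬Any w∉W , ℕₚ.≤-refl)
        (no x≢w)   → do
          (W′ , σ , x∉W′ , W≤) ← removeOne x W uW
          let x∉w∷W′ = λ { (here x≡w) → x≢w x≡w ; (there x∈W′) → x∉W′ x∈W′ }
          pure (w ∷ W′ , refl ∷ σ , x∉w∷W′ , s≤s W≤)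

    removeAll : (S W : List V) → Unique W →
                ¬ ¬ (Σ (List V) λ W′ → W′ ⊑ W × All (_∉ S) W′ ×
                                       length W ℕ.≤ length S ℕ.+ length W′)
    removeAll []      W uW = pure (W , Sublist.⊆-refl , All.universal (λ _ ()) W , ℕₚ.≤-refl)
    removeAll (s ∷ S) W uW = do
      (W₁ , σ₁ , W₁∉S , W≤) ← removeAll S W uW
      (W₂ , σ₂ , s∉W₂ , W₁≤) ← removeOne s W₁ (unique-⊑ σ₁ uW)
      let W₂∉S = All-resp-⊆ σ₂ W₁∉S
          W₂∉s∷S = λ {w} (w∈W₂ : w ∈ W₂) →
            λ { (here refl) → s∉W₂ w∈W₂ ; (there w∈S) → All.lookup W₂∉S w∈W₂ w∈S }
          W≤s∷S+W₂ = ℕₚ.≤-trans W≤ (ℕₚ.≤-trans (ℕₚ.+-monoʳ-≤ (length S) W₁≤)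
                                               (ℕₚ.≤-reflexive (ℕₚ.+-suc _ _)))
      pure (W₂ , Sublist.⊆-trans σ₂ σ₁ , All.tabulate W₂∉s∷S , W≤s∷S+W₂)

    fill : ∀ n {S′ W′ : List V} → Unique S′ → Unique W′ → All (_∉ S′) W′ →
           length S′ ℕ.≤ n → n ℕ.≤ length S′ ℕ.+ length W′ →
           Σ (List V) λ Z → Unique Z × length Z ≡ n × S′ ⊆ Z
    fill n {S′} {W′} uS′ uW′ W′∉S′ S′≤n n≤ =
      S′ ++ T , ++⁺ uS′ (take⁺ j uW′) disjoint , length-S′++T , ∈-++⁺ˡ
      where
      j = n ℕ.∸ length S′
      T = take j W′
      disjoint : ∀ {v} → ¬ (v ∈ S′ × v ∈ T)
      disjoint (v∈S′ , v∈T) = All.lookup (All-take⁺ j W′∉S′) v∈T v∈S′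
      length-S′++T : length (S′ ++ T) ≡ n
      length-S′++T = begin
        length (S′ ++ T)                 ≡⟨ length-++ S′ ⟩
        length S′ ℕ.+ length T           ≡⟨ cong (length S′ ℕ.+_) (length-take j W′) ⟩
        length S′ ℕ.+ (j ℕ.⊓ length W′)  ≡⟨ cong (length S′ ℕ.+_) (ℕₚ.m≤n⇒m⊓n≡m j≤W′) ⟩
        length S′ ℕ.+ j                  ≡⟨ ℕₚ.m+[n∸m]≡n S′≤n ⟩
        n                                ∎
        where
        open ≡-Reasoning
        j≤W′ = ℕₚ.m≤n+o⇒m∸n≤o n (length S′) n≤

    enclose : (n : ℕ) (W : List V) → Unique W → n ℕ.≤ length W →
              (S : List V) → length S ℕ.≤ n →
              ¬ ¬ (Σ (List V) λ Z → Unique Z × length Z ≡ n × S ⊆ Z)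
    enclose n W uW n≤W S S≤n = do
      (S′ , uS′ , S′≤S , S⊆S′) ← dedup S
      (W′ , σ , W′∉S′ , W≤) ← removeAll S′ W uW
      let (Z , uZ , lZ , S′⊆Z) = fill n uS′ (unique-⊑ σ uW) W′∉S′
                                      (ℕₚ.≤-trans S′≤S S≤n) (ℕₚ.≤-trans n≤W W≤)
      pure (Z , uZ , lZ , λ {_} s∈S → S′⊆Z (S⊆S′ s∈S))

  Δ : {V : Set} → (V → V → ℤ) → V → List V → ℤ
  Δ d x = sumOver (d x)

  F : {V : Set} → (V → V → ℤ) → List V → ℤ
  F d []      = 0ℤ
  F d (x ∷ K) = Δ d x K + F d K

  module _ {V : Set} (d : V → V → ℤ) where

    Δ-↭ : ∀ x {L L′ : List V} → L ↭ L′ → Δ d x L ≡ Δ d x L′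
    Δ-↭ x Perm.refl                          = refl
    Δ-↭ x (Perm.prep y σ)                    = cong (_+_ (d x y)) (Δ-↭ x σ)
    Δ-↭ x (Perm.swap y z σ) rewrite Δ-↭ x σ = exchange (d x y) (d x z) _
      where
      exchange : ∀ a b c → a + (b + c) ≡ b + (a + c)
      exchange = solve-∀
    Δ-↭ x (Perm.trans σ τ)                   = trans (Δ-↭ x σ) (Δ-↭ x τ)

    F-↭ : (∀ x y → d x y ≡ d y x) → {K K′ : List V} → K ↭ K′ → F d K ≡ F d K′
    F-↭ d-sym Perm.refl         = refl
    F-↭ d-sym (Perm.prep y σ)   = cong₂ _+_ (Δ-↭ y σ) (F-↭ d-sym σ)
    F-↭ d-sym (Perm.swap {xs = K} {ys = K′} y z σ)
      rewrite Δ-↭ y σ | Δ-↭ z σ | F-↭ d-sym σ | d-sym y z =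
      exchange (d z y) (Δ d y K′) (Δ d z K′) (F d K′)
      where
      exchange : ∀ a b c f → a + b + (c + f) ≡ a + c + (b + f)
      exchange = solve-∀
    F-↭ d-sym (Perm.trans σ τ)  = trans (F-↭ d-sym σ) (F-↭ d-sym τ)

    -- Double counting for Δ: deleting one entry of L at a time omits each
    -- pair {y,z}, z ∈ L, exactly once.
    Δ-dropOne : ∀ y L → sumOver (Δ d y) (dropOne L) + Δ d y L ≡ + length L * Δ d y L
    Δ-dropOne y []      = refl
    Δ-dropOne y (z ∷ L) = begin
      Δ d y L + sumOver (Δ d y) (map (z ∷_) (dropOne L)) + (d y z + Δ d y L)
        ≡⟨ cong (λ s → Δ d y L + s + (d y z + Δ d y L)) prefixed ⟩
      Δ d y L + (n * d y z + S) + (d y z + Δ d y L)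
        ≡⟨ regroup (Δ d y L) (d y z) n S ⟩
      (S + Δ d y L) + (n * d y z + (d y z + Δ d y L))
        ≡⟨ cong (_+ (n * d y z + (d y z + Δ d y L))) (Δ-dropOne y L) ⟩
      n * Δ d y L + (n * d y z + (d y z + Δ d y L))
        ≡⟨ collect (Δ d y L) (d y z) n ⟩
      (1ℤ + n) * (d y z + Δ d y L) ∎
      where
      open ≡-Reasoning
      n = + length L
      S = sumOver (Δ d y) (dropOne L)
      prefixed : sumOver (Δ d y) (map (z ∷_) (dropOne L)) ≡ n * d y z + S
      prefixed = begin
        sumOver (Δ d y) (map (z ∷_) (dropOne L))     ≡⟨ sumOver-map (Δ d y) (z ∷_) (dropOne L) ⟩
        sumOver (λ R → d y z + Δ d y R) (dropOne L)  ≡⟨ sumOver-shift (d y z) (Δ d y) (dropOne L) ⟩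
        + length (dropOne L) * d y z + S
          ≡⟨ cong (λ l → + l * d y z + S) (length-dropOne L) ⟩
        n * d y z + S                                ∎
      regroup : ∀ a b n s → a + (n * b + s) + (b + a) ≡ (s + a) + (n * b + (b + a))
      regroup = solve-∀
      collect : ∀ a b n → n * a + (n * b + (b + a)) ≡ (1ℤ + n) * (b + a)
      collect = solve-∀

    F-dropOne : ∀ U → sumOver (F d) (dropOne U) + + 2 * F d U ≡ + length U * F d U
    F-dropOne []      = refl
    F-dropOne (z ∷ L) = begin
      F d L + sumOver (F d) (map (z ∷_) (dropOne L)) + + 2 * (Δ d z L + F d L)
        ≡⟨ cong (λ s → F d L + s + + 2 * (Δ d z L + F d L)) prefixed ⟩
      F d L + (SΔ + SF) + + 2 * (Δ d z L + F d L)
        ≡⟨ regroup (Δ d z L) (F d L) SΔ SF ⟩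
      (SΔ + Δ d z L) + (SF + + 2 * F d L) + (Δ d z L + F d L)
        ≡⟨ cong₂ (λ a b → a + b + (Δ d z L + F d L)) (Δ-dropOne z L) (F-dropOne L) ⟩
      n * Δ d z L + n * F d L + (Δ d z L + F d L)
        ≡⟨ collect (Δ d z L) (F d L) n ⟩
      (1ℤ + n) * (Δ d z L + F d L) ∎
      where
      open ≡-Reasoning
      n = + length L
      SΔ = sumOver (Δ d z) (dropOne L)
      SF = sumOver (F d) (dropOne L)
      prefixed : sumOver (F d) (map (z ∷_) (dropOne L)) ≡ SΔ + SF
      prefixed = trans (sumOver-map (F d) (z ∷_) (dropOne L))
                       (sumOver-+ (Δ d z) (F d) (dropOne L))
      regroup : ∀ a f s t → f + (s + t) + + 2 * (a + f) ≡ (s + a) + (t + + 2 * f) + (a + f)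
      regroup = solve-∀
      collect : ∀ a f n → n * a + n * f + (a + f) ≡ (1ℤ + n) * (a + f)
      collect = solve-∀

    deletion-sum : ∀ {c} U → length U ≡ suc (suc c) → sumOver (F d) (dropOne U) ≡ + c * F d U
    deletion-sum {c} U lU = begin
      sumOver (F d) (dropOne U)                              ≡⟨ add-subtract _ (+ 2 * F d U) ⟨
      sumOver (F d) (dropOne U) + + 2 * F d U - + 2 * F d U  ≡⟨ cong (_- + 2 * F d U) (F-dropOne U) ⟩
      + length U * F d U - + 2 * F d U
        ≡⟨ cong (λ l → + l * F d U - + 2 * F d U) lU ⟩
      (+ 2 + + c) * F d U - + 2 * F d U                      ≡⟨ subtract-two (+ c) (F d U) ⟩
      + c * F d U                                            ∎
      where
      open ≡-Reasoning
      add-subtract : ∀ s t → s + t - t ≡ s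
      add-subtract = solve-∀
      subtract-two : ∀ c f → (+ 2 + c) * f - + 2 * f ≡ c * f
      subtract-two = solve-∀

  module WeightsModulo (p : ℕ) {V : Set} (d : V → V → ℤ) where
    open Modulo p

    Null : ℕ → Set
    Null n = ∀ K → Unique K → length K ≡ n → F d K ≈ 0ℤ

    -- By deletion-sum, c · F(U) is a sum of weights of (c+1)-sets; so if
    -- c+1 is null and p ∤ c, then c+2 is null.
    null-step : Prime p → ∀ c → ¬ (p ℕᵈ.∣ c) → Null (suc c) → Null (suc (suc c))
    null-step p-prime c p∤c null U uU lU = cancel p-prime c p∤c $ begin
      + c * F d U                  ≡⟨ deletion-sum d U lU ⟨
      sumOver (F d) (dropOne U)    ≈⟨ sumOver-≈ (F d) 0ℤ (dropOne U) deleted-null ⟩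
      + length (dropOne U) * 0ℤ    ≡⟨ ℤₚ.*-zeroʳ (+ length (dropOne U)) ⟩
      0ℤ                           ∎
      where
      open ≈-Reasoning
      deleted-null : ∀ {R} → R ∈ dropOne U → F d R ≈ 0ℤ
      deleted-null {R} R∈ with _ , σ ← dropOne-↭ R∈ with _ ∷ uR ← unique-↭ σ uU =
        null R uR (ℕₚ.suc-injective (trans (sym (↭-length σ)) lU))

    -- Inclusion–exclusion, F(Z) − d(u,v) = F(Z∖u) + F(Z∖v) − F(Z∖{u,v}): if n
    -- and n+1 are null, each pair of an (n+2)-set Z has weight ≡ F(Z).
    pair≈total : (∀ x y → d x y ≡ d y x) → ∀ {n} → Null n → Null (suc n) →
                 ∀ {Z u v} → Unique Z → length Z ≡ suc (suc n) →
                 u ∈ Z → v ∈ Z → u ≢ v → d u v ≈ F d Z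
    pair≈total d-sym null₀ null₁ {Z} {u} {v} uZ lZ u∈Z v∈Z u≢v
      with K , σ ← extractPair u∈Z v∈Z u≢v
      with (_ ∷ u∉K) ∷ v∉K ∷ uK ← unique-↭ σ uZ = begin
        d u v            ≈⟨ ≈-sym (≈-by inclusion-exclusion divisible) ⟩
        F d (u ∷ v ∷ K)  ≡⟨ F-↭ d d-sym (↭-sym σ) ⟩
        F d Z            ∎
      where
      open ≈-Reasoning
      lK : length K ≡ _
      lK = ℕₚ.suc-injective (ℕₚ.suc-injective (trans (sym (↭-length σ)) lZ))
      divisible : + p ∣ F d (u ∷ K) + (F d (v ∷ K) - F d K)
      divisible = ∣m∣n⇒∣m+n (≈0⇒∣ (null₁ (u ∷ K) (u∉K ∷ uK) (cong suc lK)))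
                    (∣m∣n⇒∣m-n (≈0⇒∣ (null₁ (v ∷ K) (v∉K ∷ uK) (cong suc lK)))
                               (≈0⇒∣ (null₀ K uK lK)))
      inclusion-exclusion : F d (u ∷ v ∷ K) - d u v ≡ F d (u ∷ K) + (F d (v ∷ K) - F d K)
      inclusion-exclusion = identity (d u v) (Δ d u K) (Δ d v K) (F d K)
        where
        identity : ∀ a b c f → a + b + (c + f) - a ≡ b + f + (c + f - f)
        identity = solve-∀

    F-uniform : ∀ {c K} → Unique K → (∀ {u v} → u ∈ K → v ∈ K → u ≢ v → d u v ≈ c) →
                F d K ≈ + choose2 (length K) * c
    F-uniform {c} {[]}    _          _     = ≈-refl
    F-uniform {c} {u ∷ K} (u∉K ∷ uK) pairs = begin
      Δ d u K + F d K
        ≈⟨ +-cong (sumOver-≈ (d u) c K from-u) (F-uniform uK within-K) ⟩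
      + length K * c + + choose2 (length K) * c
        ≡⟨ ℤₚ.*-distribʳ-+ c (+ length K) (+ choose2 (length K)) ⟨
      + choose2 (length (u ∷ K)) * c ∎
      where
      open ≈-Reasoning
      from-u : ∀ {v} → v ∈ K → d u v ≈ c
      from-u v∈K = pairs (here refl) (there v∈K) (All.lookup u∉K v∈K)
      within-K : ∀ {v w} → v ∈ K → w ∈ K → v ≢ w → d v w ≈ c
      within-K v∈K w∈K = pairs (there v∈K) (there w∈K)

  χ : Bool → ℤ
  χ true  = 1ℤ
  χ false = 0ℤ

  δ : Bool → Bool → ℤ
  δ a b = χ a - χ b

  ∣δ∣≤1 : ∀ a b → ∣ δ a b ∣ ℕ.≤ 1
  ∣δ∣≤1 true  true  = z≤n
  ∣δ∣≤1 true  false = s≤s z≤n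
  ∣δ∣≤1 false true  = s≤s z≤n
  ∣δ∣≤1 false false = z≤n

  δ≡0⇒≡ : ∀ a b → δ a b ≡ 0ℤ → a ≡ b
  δ≡0⇒≡ true  true  _ = refl
  δ≡0⇒≡ false false _ = refl
  δ≡0⇒≡ true  false ()
  δ≡0⇒≡ false true  ()

  δ≡1⇒ : ∀ a b → δ a b ≡ 1ℤ → a ≡ true × b ≡ false
  δ≡1⇒ true  false _ = refl , refl
  δ≡1⇒ true  true  ()
  δ≡1⇒ false true  ()
  δ≡1⇒ false false ()

  δ≡-1⇒ : ∀ a b → δ a b ≡ -1ℤ → a ≡ false × b ≡ true
  δ≡-1⇒ false true  _ = refl , refl
  δ≡-1⇒ true  true  ()
  δ≡-1⇒ true  false ()
  δ≡-1⇒ false false ()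

  -- Since |δ| ≤ 1, congruences between values of δ are equalities: with 0
  -- modulo p ≥ 2, and with each other modulo p ≥ 3.
  module _ (p : ℕ) where
    open Modulo p

    δ≈0⇒≡ : 2 ℕ.≤ p → ∀ a b → δ a b ≈ 0ℤ → a ≡ b
    δ≈0⇒≡ 2≤p a b δ≈0 = δ≡0⇒≡ a b (≈-small δ≈0 (ℕₚ.≤-trans (s≤s ∣δ-0∣≤1) 2≤p))
      where
      ∣δ-0∣≤1 : ∣ δ a b - 0ℤ ∣ ℕ.≤ 1
      ∣δ-0∣≤1 = subst (ℕ._≤ 1) (cong ∣_∣ (sym (ℤₚ.+-identityʳ (δ a b)))) (∣δ∣≤1 a b)

    δ≈δ⇒≡ : 3 ℕ.≤ p → ∀ a b a′ b′ → δ a b ≈ δ a′ b′ → δ a b ≡ δ a′ b′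
    δ≈δ⇒≡ 3≤p a b a′ b′ δ≈δ = ≈-small δ≈δ (ℕₚ.≤-trans (s≤s ∣δ-δ∣≤2) 3≤p)
      where
      ∣δ-δ∣≤2 : ∣ δ a b - δ a′ b′ ∣ ℕ.≤ 2
      ∣δ-δ∣≤2 = ℕₚ.≤-trans (ℤₚ.∣i-j∣≤∣i∣+∣j∣ (δ a b) (δ a′ b′))
                           (ℕₚ.+-mono-≤ (∣δ∣≤1 a b) (∣δ∣≤1 a′ b′))

  degIn-χ : {V : Set} (H : Graph V) (x : V) (L : List V) →
            + degIn H x L ≡ sumOver (λ y → χ (adj H x y)) L
  degIn-χ H x []      = refl
  degIn-χ H x (y ∷ L) with adj H x y
  ... | true  = cong (_+_ 1ℤ) (degIn-χ H x L)
  ... | false = trans (degIn-χ H x L) (sym (ℤₚ.+-identityˡ _))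

  module _ {V : Set} (G G′ : Graph V) where

    diff : V → V → ℤ
    diff x y = δ (adj G x y) (adj G′ x y)

    diff-sym : ∀ x y → diff x y ≡ diff y x
    diff-sym x y = cong₂ δ (Graph.sym G x y) (Graph.sym G′ x y)

    F-diff : ∀ K → F diff K ≡ + edgesIn G K - + edgesIn G′ K
    F-diff []      = refl
    F-diff (x ∷ K) = begin
      Δ diff x K + F diff K
        ≡⟨ cong₂ _+_ (sumOver-sub (χ ∘ adj G x) (χ ∘ adj G′ x) K) (F-diff K) ⟩
      sumOver (χ ∘ adj G x) K - sumOver (χ ∘ adj G′ x) K + (eG - eG′)
        ≡⟨ cong₂ (λ a b → a - b + (eG - eG′)) (degIn-χ G x K) (degIn-χ G′ x K) ⟨
      + degIn G x K - + degIn G′ x K + (eG - eG′)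
        ≡⟨ minus-interchange (+ degIn G x K) (+ degIn G′ x K) eG eG′ ⟩
      + edgesIn G (x ∷ K) - + edgesIn G′ (x ∷ K) ∎
      where
      open ≡-Reasoning
      eG = + edgesIn G K
      eG′ = + edgesIn G′ K

    congruent⇒null : ∀ p n → (∀ K → IsKSubset n K → edgesIn G K ≡ edgesIn G′ K [mod p ]) →
                     WeightsModulo.Null p diff n
    congruent⇒null p n congruent K uK lK =
      Modulo.∣⇒≈0 p (subst (+ p ∣_) (sym (F-diff K)) (∣ᵤ⇒∣ (congruent K (uK , lK))))

    same-off-diagonal : (∀ x y → x ≢ y → ¬ ¬ (adj G x y ≡ adj G′ x y)) → SameGraph G G′
    same-off-diagonal = everywhere (λ x y → adj G x y ≟ᵇ adj G′ x y)
                                   (λ x → trans (irrefl G x) (sym (irrefl G′ x)))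

    constant-diff : ∀ b b′ → (∀ x y → x ≢ y → diff x y ≡ δ b b′) →
                    SameGraph G G′ ⊎ ((Complete G × Empty G′) ⊎ (Empty G × Complete G′))
    constant-diff true  true  const = inj₁ (same-off-diagonal λ x y x≢y →
      pure (δ≡0⇒≡ (adj G x y) (adj G′ x y) (const x y x≢y)))
    constant-diff false false const = inj₁ (same-off-diagonal λ x y x≢y →
      pure (δ≡0⇒≡ (adj G x y) (adj G′ x y) (const x y x≢y)))
    constant-diff true  false const = inj₂ (inj₁ (complete , empty))
      where
      bits : ∀ {x y} → x ≢ y → adj G x y ≡ true × adj G′ x y ≡ false
      bits {x} {y} x≢y = δ≡1⇒ (adj G x y) (adj G′ x y) (const x y x≢y)
      complete : Complete G
      complete x y = proj₁ ∘ bits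
      empty : Empty G′
      empty = everywhere (λ x y → adj G′ x y ≟ᵇ false) (irrefl G′) (λ x y → pure ∘ proj₂ ∘ bits)
    constant-diff false true  const = inj₂ (inj₂ (empty , complete))
      where
      bits : ∀ {x y} → x ≢ y → adj G x y ≡ false × adj G′ x y ≡ true
      bits {x} {y} x≢y = δ≡-1⇒ (adj G x y) (adj G′ x y) (const x y x≢y)
      empty : Empty G
      empty = everywhere (λ x y → adj G x y ≟ᵇ false) (irrefl G) (λ x y → pure ∘ proj₁ ∘ bits)
      complete : Complete G′
      complete x y = proj₂ ∘ bits

  -- The three parts of the theorem, for k = m + 2 ≥ 2, a duplicate-free list
  -- W of k + 2 vertices, and graphs for which size k is null.
  module Parts {V : Set} (G G′ : Graph V) (p : ℕ) (p-prime : Prime p) (m : ℕ)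
               (W : List V) (uW : Unique W) (lW : length W ≡ 4 ℕ.+ m)
               (k-null : WeightsModulo.Null p (diff G G′) (2 ℕ.+ m)) where
    open Modulo p
    open WeightsModulo p (diff G G′)

    d : V → V → ℤ
    d = diff G G′

    2≤p : 2 ℕ.≤ p
    2≤p = nonTrivial⇒n>1 p {{prime⇒nonTrivial p-prime}}

    around : (S : List V) → length S ℕ.≤ 4 ℕ.+ m →
             ¬ ¬ (Σ (List V) λ Z → Unique Z × length Z ≡ 4 ℕ.+ m × S ⊆ Z)
    around = enclose (4 ℕ.+ m) W uW (ℕₚ.≤-reflexive (sym lW))

    -- If p ∤ k−1, then k+1 is null and each pair of a (k+2)-set Z has
    -- weight ≡ F(Z).
    pairs≈ : ¬ (p ℕᵈ.∣ 1 ℕ.+ m) → ∀ {Z u v} → Unique Z → length Z ≡ 4 ℕ.+ m →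
             u ∈ Z → v ∈ Z → u ≢ v → d u v ≈ F d Z
    pairs≈ p∤k-1 =
      pair≈total (diff-sym G G′) k-null (null-step p-prime (1 ℕ.+ m) p∤k-1 k-null)

    -- If moreover k+2 is null, every pair has weight ≡ 0, so G = G′.
    same-if-null : ¬ (p ℕᵈ.∣ 1 ℕ.+ m) → Null (4 ℕ.+ m) → SameGraph G G′
    same-if-null p∤k-1 null = same-off-diagonal G G′ λ x y x≢y → do
      (Z , uZ , lZ , xy⊆Z) ← around (x ∷ y ∷ []) (s≤s (s≤s z≤n))
      let dxy≈F = pairs≈ p∤k-1 uZ lZ (xy⊆Z (here refl)) (xy⊆Z (there (here refl))) x≢y
      pure (δ≈0⇒≡ p 2≤p (adj G x y) (adj G′ x y) (≈-trans dxy≈F (null Z uZ lZ)))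

    -- Part 1: if p ∤ k−1 and p ∤ k, then k+2 is null.
    part1 : ¬ (p ℕᵈ.∣ 1 ℕ.+ m) → ¬ (p ℕᵈ.∣ 2 ℕ.+ m) → SameGraph G G′
    part1 p∤k-1 p∤k = same-if-null p∤k-1 (null-step p-prime (2 ℕ.+ m) p∤k k+1-null)
      where
      k+1-null = null-step p-prime (1 ℕ.+ m) p∤k-1 k-null

    -- Part 2: for p ≥ 3 any two pairs lie in a common (k+2)-set, so their
    -- weights are congruent, hence equal: d is constant.
    part2 : 3 ℕ.≤ p → ¬ (p ℕᵈ.∣ 1 ℕ.+ m) →
            SameGraph G G′ ⊎ ((Complete G × Empty G′) ⊎ (Empty G × Complete G′))
    part2 3≤p p∤k-1
      with w₁ , w₂ , w₁≢w₂ ← two-distinct W uW (subst (2 ℕ.≤_) (sym lW) (s≤s (s≤s z≤n))) =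
      constant-diff G G′ (adj G w₁ w₂) (adj G′ w₁ w₂) λ x y x≢y →
        decidable-stable (d x y ℤ.≟ d w₁ w₂) (d-agrees x y x≢y)
      where
      d-agrees : ∀ x y → x ≢ y → ¬ ¬ (d x y ≡ d w₁ w₂)
      d-agrees x y x≢y = do
        (Z , uZ , lZ , S⊆Z) ← around (x ∷ y ∷ w₁ ∷ w₂ ∷ []) (s≤s (s≤s (s≤s (s≤s z≤n))))
        let dxy≈F = pairs≈ p∤k-1 uZ lZ (S⊆Z (here refl)) (S⊆Z (there (here refl))) x≢y
            dw≈F  = pairs≈ p∤k-1 uZ lZ (S⊆Z (there (there (here refl))))
                                       (S⊆Z (there (there (there (here refl))))) w₁≢w₂
        pure (δ≈δ⇒≡ p 3≤p (adj G x y) (adj G′ x y) (adj G w₁ w₂) (adj G′ w₁ w₂)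
                          (≈-trans dxy≈F (≈-sym dw≈F)))

    -- Part 3: for p = 2 and k = 4q + 2, a k-set K inside a (k+2)-set Z has
    -- 0 ≡ F(K) ≡ C(k,2)·F(Z) with C(k,2) odd, so k+2 is null.
    part3 : p ≡ 2 → ∀ q → m ≡ q ℕ.* 4 → SameGraph G G′
    part3 p≡2 q m≡4q = same-if-null p∤k-1 k+2-null
      where
      p∤k-1 : ¬ (p ℕᵈ.∣ 1 ℕ.+ m)
      p∤k-1 = subst₂ (λ p n → ¬ (p ℕᵈ.∣ 1 ℕ.+ n)) (sym p≡2) (sym m≡4q) (2∤1+4q q)
      k+2-null : Null (4 ℕ.+ m)
      k+2-null Z@(_ ∷ _ ∷ K) uZ@(_ ∷ _ ∷ uK) lZ with t , odd ← choose2-odd q =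
        odd-cancel p≡2 t $ begin
          + (1 ℕ.+ t ℕ.* 2) * F d Z     ≡⟨ cong (λ c → + c * F d Z) choose2-k ⟩
          + choose2 (length K) * F d Z  ≈⟨ F-uniform uK pairs-of-K ⟨
          F d K                         ≈⟨ k-null K uK lK ⟩
          0ℤ                            ∎
        where
        open ≈-Reasoning
        lK : length K ≡ 2 ℕ.+ m
        lK = ℕₚ.suc-injective (ℕₚ.suc-injective lZ)
        choose2-k : 1 ℕ.+ t ℕ.* 2 ≡ choose2 (length K)
        choose2-k = trans (sym odd) (cong choose2 (trans (cong (2 ℕ.+_) (sym m≡4q)) (sym lK)))
        pairs-of-K : ∀ {u v} → u ∈ K → v ∈ K → u ≢ v → d u v ≈ F d Z
        pairs-of-K u∈K v∈K = pairs≈ p∤k-1 uZ lZ (there (there u∈K)) (there (there v∈K))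

open import Defs
open import Data.Nat using (ℕ; _+_; _≤_; _∸_; _%_)
open import Data.Nat.Primality using (Prime)
open import Data.List using (List; length)
open import Data.List.Relation.Unary.Unique.Propositional using (Unique)
open import Data.Product using (_×_; Σ)
open import Data.Sum using (_⊎_)
open import Relation.Nullary using (¬_)
open import Relation.Binary.PropositionalEquality using (_≡_)

open import Function using (_∘_)
open import Data.Nat using (suc; s≤s; _*_; _/_)
open import Data.Nat.Base using (nonTrivial⇒≢1)
open import Data.Nat.Properties using (+-comm; +-identityʳ; suc-injective)
open import Data.Nat.Divisibility using (_∣_; ∣1⇒≡1; ∣m+n∣m⇒∣n)
open import Data.Nat.DivMod using (m≡m%n+[m/n]*n)
open import Data.Nat.Primality using (prime⇒nonTrivial)
open import Data.Product using (_,_)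
import Relation.Binary.PropositionalEquality as Eq
open SignedEdgeCounts using (module Parts; congruent⇒null)

prime∣suc⇒∤ : ∀ {p n} → Prime p → p ∣ suc n → ¬ (p ∣ n)
prime∣suc⇒∤ {p} {n} p-prime p∣n+1 p∣n =
  nonTrivial⇒≢1 {{prime⇒nonTrivial p-prime}}
    (∣1⇒≡1 (∣m+n∣m⇒∣n (Eq.subst (p ∣_) (+-comm 1 n) p∣n+1) p∣n))

mod4≡2 : ∀ m → (2 + m) % 4 ≡ 2 → m ≡ (2 + m) / 4 * 4
mod4≡2 m k%4≡2 = suc-injective (suc-injective
  (Eq.trans (m≡m%n+[m/n]*n (2 + m) 4) (Eq.cong (_+ (2 + m) / 4 * 4) k%4≡2)))

-- For k = m + 2, the hypothesis "k ≡ 1 [mod p]" unfolds to p ∣ m + 1 and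
-- "k ≡ 0 [mod p]" to p ∣ k + 0.
theorem1p5 : (p k : ℕ) → Prime p → 2 ≤ k
    → (V : Set)
    → Σ (List V) (λ W → Unique W × length W ≡ k + 2)
    → (G G' : Graph V)
    → (∀ (K : List V) → IsKSubset k K → edgesIn G K ≡ edgesIn G' K [mod p ])
    → ((3 ≤ p → ¬ (k ≡ 0 [mod p ]) → ¬ (k ≡ 1 [mod p ]) → SameGraph G G')
      × (3 ≤ p → k ≡ 0 [mod p ]
          → SameGraph G G' ⊎ ((Complete G × Empty G') ⊎ (Empty G × Complete G')))
      × (p ≡ 2 → k % 4 ≡ 2 → SameGraph G G'))
theorem1p5 p (suc (suc m)) p-prime (s≤s (s≤s _)) V (W , uW , lW) G G' congruent =
    (λ _ k≢0 k≢1 → part1 k≢1 (k≢0 ∘ Eq.subst (p ∣_) (Eq.sym k+0≡k)))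
  , (λ 3≤p k≡0 → part2 3≤p (prime∣suc⇒∤ p-prime (Eq.subst (p ∣_) k+0≡k k≡0)))
  , (λ p≡2 k%4≡2 → part3 p≡2 ((2 + m) / 4) (mod4≡2 m k%4≡2))
  where
  k+0≡k = +-identityʳ (2 + m)
  open Parts G G' p p-prime m W uW (Eq.trans lW (Eq.cong (suc ∘ suc) (+-comm m 2)))
             (congruent⇒null G G' p (2 + m) congruent)
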